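{- For any set $A\subseteq[0,n]$ of integers, the set $A\cup\{4n\}$ is primitive.
   Context: $[0,n]=\{0,1,\dots,n\}$. For sets $A,B\subseteq\mathbb{Z}$, $A+B=\{a+b:a\in A,b\in B\}$. A set $A$ in an abelian group is called primitive if whenever $A+A=B+B$ for some set $B$, then $B=A+x$ for some group element $x$ with $2x=0$ (over $\mathbb{Z}$ this means $B=A$). -}

module Defs where

open import Level using (0ℓ)
open import Data.Nat using (ℕ)
open import Data.Integer using (ℤ; +_; _+_; _*_; _≤_)
open import Data.Product using (Σ; ∃; _×_)
open import Relation.Binary.PropositionalEquality using (_≡_)
open import Relation.Unary using (Pred; _⊆_; _≐_; _∪_; ｛_｝)

ZSet : Set₁
ZSet = Pred ℤ 0ℓ

_⊕_ : ZSet → ZSet → ZSet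
(A ⊕ B) z = Σ ℤ λ a → Σ ℤ λ b → A a × B b × z ≡ a + b

_⊞_ : ZSet → ℤ → ZSet
(A ⊞ x) z = Σ ℤ λ a → A a × z ≡ a + x

interval : ℕ → ZSet
interval n z = (+ 0 ≤ z) × (z ≤ + n)

Primitive : ZSet → Set₁
Primitive A = (B : ZSet) → (A ⊕ A) ≐ (B ⊕ B) →
  Σ ℤ λ x → (x + x ≡ + 0) × (B ≐ (A ⊞ x))

-- Put S = A ∪ {F} with F = 4n. The point is that F is rigid: as n + n < 4n (or n = 0, when
-- S = {0}), an equation x + F = s + s′ with x ≥ 0 and s, s′ ∈ S forces s = F or s′ = F.
-- If S + S = B + B, halving gives B ⊆ [0, F], and F + F ∈ B + B then forces F ∈ B. For
-- b ∈ B, b + F ∈ S + S must be s + F with s ∈ S, so b = s; symmetrically, for s ∈ S,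
-- s + F ∈ B + B must be b + F with b ∈ B ⊆ S, so s = b. Hence B = S.
module Submission where

open import Defs
open import Data.Nat using (ℕ; _*_)
open import Data.Integer using (ℤ; +_)
open import Relation.Unary using (_⊆_; _∪_; ｛_｝)

open import Data.Nat as ℕ using (zero; suc; NonZero; z≤n; s≤s)
import Data.Nat.Properties as ℕ
open import Data.Integer using (_+_; _≤_; +≤+)
import Data.Integer.Properties as ℤ
open import Algebra.Properties.AbelianGroup ℤ.+-0-abelianGroup using (∙-cancelʳ)
open import Data.Product using (_×_; _,_; proj₁; proj₂)
open import Data.Sum using (_⊎_; inj₁; inj₂)
open import Data.Empty using (⊥-elim)
open import Relation.Binary.PropositionalEquality using (_≡_; refl; sym; trans; subst)
open import Relation.Unary using (_≐_)

Icc : ℤ → ℤ → ZSet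
Icc l h z = (l ≤ z) × (z ≤ h)

x+x≤y+y⇒x≤y : ∀ {x y} → x + x ≤ y + y → x ≤ y
x+x≤y+y⇒x≤y h = ℤ.≮⇒≥ λ y<x → ℤ.<⇒≱ (ℤ.+-mono-< y<x y<x) h

x+y≡m+m⇒x≡m : ∀ {x y m} → x ≤ m → y ≤ m → x + y ≡ m + m → x ≡ m
x+y≡m+m⇒x≡m x≤m y≤m eq =
  ℤ.≤-antisym x≤m (ℤ.≮⇒≥ λ x<m → ℤ.<-irrefl eq (ℤ.+-mono-<-≤ x<m y≤m))

∈-cancel-common-summand : ∀ {T : ZSet} {x y z w} →
  x + y ≡ z + w → z ≡ y ⊎ w ≡ y → T z → T w → T x
∈-cancel-common-summand {T} {x} {y} {z} {w} eq (inj₁ refl) _ Tw =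
  subst T (sym (∙-cancelʳ y x w (trans eq (ℤ.+-comm y w)))) Tw
∈-cancel-common-summand {T} {x} {y} {z} {w} eq (inj₂ refl) Tz _ =
  subst T (sym (∙-cancelʳ y x z eq)) Tz

⊕-Icc : ∀ {A l h} → A ⊆ Icc l h → (A ⊕ A) ⊆ Icc (l + l) (h + h)
⊕-Icc A⊆I (a , a′ , Aa , Aa′ , refl) =
  ℤ.+-mono-≤ (proj₁ (A⊆I Aa)) (proj₁ (A⊆I Aa′)) , ℤ.+-mono-≤ (proj₂ (A⊆I Aa)) (proj₂ (A⊆I Aa′))

Icc-halve : ∀ {l h x} → Icc (l + l) (h + h) (x + x) → Icc l h x
Icc-halve (ll≤xx , xx≤hh) = x+x≤y+y⇒x≤y ll≤xx , x+x≤y+y⇒x≤y xx≤hh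

⊞-identityʳ : (A : ZSet) → (A ⊞ (+ 0)) ≐ A
⊞-identityʳ A =
  (λ { (a , Aa , refl) → subst A (sym (ℤ.+-identityʳ a)) Aa }) ,
  (λ {z} Az → z , Az , sym (ℤ.+-identityʳ z))

module RigidTop
  (S : ZSet) (F : ℤ)
  (S⊆[0,F] : S ⊆ Icc (+ 0) F)
  (F∈S : S F)
  (F-forced : ∀ {x s s′} → + 0 ≤ x → S s → S s′ → x + F ≡ s + s′ → s ≡ F ⊎ s′ ≡ F)
  where

  module _ (B : ZSet) (S⊕S≐B⊕B : (S ⊕ S) ≐ (B ⊕ B)) where

    private
      B⊕B⊆S⊕S : (B ⊕ B) ⊆ (S ⊕ S)
      B⊕B⊆S⊕S = proj₂ S⊕S≐B⊕B

      S⊕S⊆B⊕B : (S ⊕ S) ⊆ (B ⊕ B)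
      S⊕S⊆B⊕B = proj₁ S⊕S≐B⊕B

    B⊆[0,F] : B ⊆ Icc (+ 0) F
    B⊆[0,F] {b} Bb = Icc-halve (⊕-Icc S⊆[0,F] (B⊕B⊆S⊕S (b , b , Bb , Bb , refl)))

    F∈B : B F
    F∈B with S⊕S⊆B⊕B (F , F , F∈S , F∈S , refl)
    ... | b , b′ , Bb , Bb′ , F+F≡b+b′ =
      subst B (x+y≡m+m⇒x≡m (proj₂ (B⊆[0,F] Bb)) (proj₂ (B⊆[0,F] Bb′)) (sym F+F≡b+b′)) Bb

    B⊆S : B ⊆ S
    B⊆S {b} Bb with B⊕B⊆S⊕S (b , F , Bb , F∈B , refl)
    ... | s , s′ , Ss , Ss′ , b+F≡s+s′ =
      ∈-cancel-common-summand b+F≡s+s′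
        (F-forced (proj₁ (B⊆[0,F] Bb)) Ss Ss′ b+F≡s+s′) Ss Ss′

    S⊆B : S ⊆ B
    S⊆B {s} Ss with S⊕S⊆B⊕B (s , F , Ss , F∈S , refl)
    ... | b , b′ , Bb , Bb′ , s+F≡b+b′ =
      ∈-cancel-common-summand s+F≡b+b′
        (F-forced (proj₁ (S⊆[0,F] Ss)) (B⊆S Bb) (B⊆S Bb′) s+F≡b+b′) Bb Bb′

  isPrimitive : Primitive S
  isPrimitive B S⊕S≐B⊕B =
    + 0 , refl , (λ Bb → proj₂ (⊞-identityʳ S) (B⊆S B S⊕S≐B⊕B Bb)) ,
                 (λ S⊞0z → S⊆B B S⊕S≐B⊕B (proj₁ (⊞-identityʳ S) S⊞0z))

n+n<4*n : ∀ n .{{_ : NonZero n}} → n ℕ.+ n ℕ.< 4 * n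
n+n<4*n n@(suc _) = ℕ.+-monoʳ-< n (ℕ.m<m+n n (s≤s z≤n))

interval-sum≡x+4n⇒≡4n : ∀ n {x a a′} → + 0 ≤ x → interval n a → interval n a′ →
  x + + (4 * n) ≡ a + a′ → a ≡ + (4 * n)
interval-sum≡x+4n⇒≡4n zero 0≤x (0≤a , a≤0) _ _ = ℤ.≤-antisym a≤0 0≤a
interval-sum≡x+4n⇒≡4n n@(suc _) 0≤x (_ , a≤n) (_ , a′≤n) eq =
  ⊥-elim (ℕ.<⇒≱ (n+n<4*n n) 4n≤n+n)
  where
  4n≤n+n : 4 * n ℕ.≤ n ℕ.+ n
  4n≤n+n = ℤ.drop‿+≤+ (ℤ.≤-trans (ℤ.+-monoˡ-≤ (+ (4 * n)) 0≤x)
                                  (subst (_≤ + (n ℕ.+ n)) (sym eq) (ℤ.+-mono-≤ a≤n a′≤n)))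

lemma3p2 : (n : ℕ) (A : ZSet) → A ⊆ interval n → Primitive (A ∪ ｛ + (4 * n) ｝)
lemma3p2 n A A⊆[0,n] = RigidTop.isPrimitive (A ∪ ｛ F ｝) F S⊆[0,F] (inj₂ refl) F-forced
  where
  F : ℤ
  F = + (4 * n)

  S⊆[0,F] : (A ∪ ｛ F ｝) ⊆ Icc (+ 0) F
  S⊆[0,F] (inj₁ Aa) = let (0≤a , a≤n) = A⊆[0,n] Aa in
    0≤a , ℤ.≤-trans a≤n (+≤+ (ℕ.m≤n*m n 4))
  S⊆[0,F] (inj₂ refl) = +≤+ z≤n , ℤ.≤-refl

  F-forced : ∀ {x s s′} → + 0 ≤ x → (A ∪ ｛ F ｝) s → (A ∪ ｛ F ｝) s′ →
    x + F ≡ s + s′ → s ≡ F ⊎ s′ ≡ F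
  F-forced _ (inj₂ F≡s) _ _ = inj₁ (sym F≡s)
  F-forced _ _ (inj₂ F≡s′) _ = inj₂ (sym F≡s′)
  F-forced 0≤x (inj₁ Aa) (inj₁ Aa′) eq =
    inj₁ (interval-sum≡x+4n⇒≡4n n 0≤x (A⊆[0,n] Aa) (A⊆[0,n] Aa′) eq)
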